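{- Let $m$ be a positive integer with $\gcd(m,6)=1$. If the equation $x^2+216y^2=8m$ has a solution $(x,y)\in\mathbb Z^2$ with $\gcd(x,y)=1$, then $m\equiv 5$ or $11\pmod{24}$. Moreover, if $(x,y)\in\mathbb Z^2$ with $\gcd(x,y)=1$ satisfies $x^2+216y^2=8m$, then: (i) if $m\equiv 5\pmod{24}$, then $\mathrm{val}_2(x)=2$; (ii) if $m\equiv 11\pmod{24}$, then $\mathrm{val}_2(x)\geqslant 3$.
   Context: $\mathrm{val}_2(x)$ denotes the $2$-adic valuation of the integer $x$, i.e. the exponent of the largest power of $2$ dividing $x$. -}

module Defs where

open import Data.Nat using (ℕ; suc; _^_)
open import Data.Integer using (ℤ; +_)
open import Data.Integer.Divisibility using (_∣_)
open import Data.Product using (_×_)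
open import Relation.Nullary using (¬_)

Val₂≡ : ℤ → ℕ → Set
Val₂≡ x k = (+ (2 ^ k) ∣ x) × ¬ (+ (2 ^ suc k) ∣ x)

-- val₂(x) ≥ k : 2^k divides x (convention val₂(0) = ∞).
Val₂≥ : ℤ → ℕ → Set
Val₂≥ x k = + (2 ^ k) ∣ x

-- Modulo 8 the equation forces 4 ∣ x, and writing x = 4u it becomes m = 2u² + 27y².
-- As 2 ∤ m and 3 ∤ m, y is odd and 3 ∤ u, so m ≡ 2 (mod 3) and m ≡ 2u² + 3 (mod 8):
-- m ≡ 5 (mod 24) when u is odd and m ≡ 11 (mod 24) when u is even.  Both residue facts
-- are finite checks, since the quantities involved only depend on residues mod 8 and 24.
module Submission where

module OverNaturals where

  open import Data.Nat
  open import Data.Nat.Properties using (*-comm; +-comm; *-cancelˡ-≡; 0≢1+n)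
  open import Data.Nat.DivMod
  open import Data.Nat.Divisibility
  open import Data.Nat.Tactic.RingSolver using (solve-∀)
  open import Data.Product using (_×_; _,_; ∃)
  import Data.Product as Product
  open import Data.Sum using (_⊎_; inj₁; inj₂)
  import Data.Sum as Sum
  open import Relation.Nullary using (¬_; contradiction; Dec)
  open import Relation.Nullary.Decidable using (toWitness; _→-dec_; _×-dec_; _⊎-dec_)
  open import Relation.Binary.PropositionalEquality
  open ≡-Reasoning

  %-cong-+ : ∀ {a b c e} d .{{_ : NonZero d}} →
             a % d ≡ b % d → c % d ≡ e % d → (a + c) % d ≡ (b + e) % d
  %-cong-+ {a} {b} {c} {e} d a≡b c≡e = begin
    (a + c) % d          ≡⟨ %-distribˡ-+ a c d ⟩
    (a % d + c % d) % d  ≡⟨ cong₂ (λ s t → (s + t) % d) a≡b c≡e ⟩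
    (b % d + e % d) % d  ≡⟨ %-distribˡ-+ b e d ⟨
    (b + e) % d          ∎

  %-cong-* : ∀ {a b c e} d .{{_ : NonZero d}} →
             a % d ≡ b % d → c % d ≡ e % d → (a * c) % d ≡ (b * e) % d
  %-cong-* {a} {b} {c} {e} d a≡b c≡e = begin
    (a * c) % d              ≡⟨ %-distribˡ-* a c d ⟩
    ((a % d) * (c % d)) % d  ≡⟨ cong₂ (λ s t → (s * t) % d) a≡b c≡e ⟩
    ((b % d) * (e % d)) % d  ≡⟨ %-distribˡ-* b e d ⟨
    (b * e) % d              ∎

  m%n%d≡0⇒d∣m : ∀ m n d .{{_ : NonZero n}} .{{_ : NonZero d}} → d ∣ n → m % n % d ≡ 0 → d ∣ m
  m%n%d≡0⇒d∣m m n d d∣n ≡0 = m%n≡0⇒n∣m m d (trans (sym (m∣n⇒o%n%m≡o%m d n m d∣n)) ≡0)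

  8∣n²⇒4∣n : ∀ n → 8 ∣ n * n → 4 ∣ n
  8∣n²⇒4∣n n 8∣n² = m%n≡0⇒n∣m n 4 (begin
    n % 4      ≡⟨ m∣n⇒o%n%m≡o%m 4 8 n (divides 2 refl) ⟨
    n % 8 % 4  ≡⟨ table (m%n<n n 8) (trans (sym (%-distribˡ-* n n 8)) (n∣m⇒m%n≡0 (n * n) 8 8∣n²)) ⟩
    0          ∎)
    where
    table : ∀ {r} → r < 8 → r * r % 8 ≡ 0 → r % 4 ≡ 0
    table = toWitness {a? = allUpTo? (λ r → r * r % 8 ≟ 0 →-dec r % 4 ≟ 0) 8} _

  Q : ℕ → ℕ → ℕ
  Q u v = 2 * (u * u) + 27 * (v * v)

  Q-cong-% : ∀ {u u′ v v′} d .{{_ : NonZero d}} →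
             u % d ≡ u′ % d → v % d ≡ v′ % d → Q u v % d ≡ Q u′ v′ % d
  Q-cong-% d u≡u′ v≡v′ = %-cong-+ d (%-cong-* {2} d refl (%-cong-* d u≡u′ u≡u′))
                                    (%-cong-* {27} d refl (%-cong-* d v≡v′ v≡v′))

  8Q≡[4u]²+216v² : ∀ u v → 8 * (2 * (u * u) + 27 * (v * v)) ≡ u * 4 * (u * 4) + 216 * (v * v)
  8Q≡[4u]²+216v² = solve-∀

  X²+216Y²≡8m⇒8∣X² : ∀ X Y m → X * X + 216 * (Y * Y) ≡ 8 * m → 8 ∣ X * X
  X²+216Y²≡8m⇒8∣X² X Y m eq = ∣m+n∣m⇒∣n 8∣sum 8∣216Y²
    where
    8∣sum : 8 ∣ 216 * (Y * Y) + X * X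
    8∣sum = divides m (trans (+-comm (216 * (Y * Y)) (X * X)) (trans eq (*-comm 8 m)))
    8∣216Y² : 8 ∣ 216 * (Y * Y)
    8∣216Y² = ∣-trans (divides 27 refl) (divides (Y * Y) (*-comm 216 (Y * Y)))

  X²+216Y²≡8m⇒X≡4U : ∀ X Y m → X * X + 216 * (Y * Y) ≡ 8 * m → ∃ λ U → X ≡ U * 4 × Q U Y ≡ m
  X²+216Y²≡8m⇒X≡4U X Y m eq = substitute (8∣n²⇒4∣n X (X²+216Y²≡8m⇒8∣X² X Y m eq)) eq
    where
    substitute : 4 ∣ X → X * X + 216 * (Y * Y) ≡ 8 * m → ∃ λ U → X ≡ U * 4 × Q U Y ≡ m
    substitute (divides U refl) eq′ = U , refl , *-cancelˡ-≡ (Q U Y) m 8 (trans (8Q≡[4u]²+216v² U Y) eq′)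

  ResidueClass : ℕ → ℕ → Set
  ResidueClass r p = r % 2 ≡ 0 ⊎ r % 3 ≡ 0 ⊎ (r ≡ 5 × p ≡ 1) ⊎ (r ≡ 11 × p ≡ 0)

  Q-residueClass : ∀ u v → ResidueClass (Q u v % 24) (u % 2)
  Q-residueClass u v = subst₂ ResidueClass
    (Q-cong-% {u % 24} {u} {v % 24} {v} 24 (m%n%n≡m%n u 24) (m%n%n≡m%n v 24)) (m∣n⇒o%n%m≡o%m 2 24 u (divides 12 refl))
    (table (m%n<n u 24) (m%n<n v 24))
    where
    class? : ∀ r p → Dec (ResidueClass r p)
    class? r p = r % 2 ≟ 0 ⊎-dec r % 3 ≟ 0 ⊎-dec (r ≟ 5 ×-dec p ≟ 1) ⊎-dec (r ≟ 11 ×-dec p ≟ 0)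
    table : ∀ {u} → u < 24 → ∀ {v} → v < 24 → ResidueClass (Q u v % 24) (u % 2)
    table = toWitness {a? = allUpTo? (λ u → allUpTo? (λ v → class? (Q u v % 24) (u % 2)) 24) 24} _

  Q-%-24 : ∀ u v → ¬ 2 ∣ Q u v → ¬ 3 ∣ Q u v →
           (Q u v % 24 ≡ 5 × ¬ 2 ∣ u) ⊎ (Q u v % 24 ≡ 11 × 2 ∣ u)
  Q-%-24 u v 2∤Q 3∤Q = classify (Q-residueClass u v)
    where
    classify : ResidueClass (Q u v % 24) (u % 2) →
               (Q u v % 24 ≡ 5 × ¬ 2 ∣ u) ⊎ (Q u v % 24 ≡ 11 × 2 ∣ u)
    classify (inj₁ ≡0) = contradiction (m%n%d≡0⇒d∣m (Q u v) 24 2 (divides 12 refl) ≡0) 2∤Q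
    classify (inj₂ (inj₁ ≡0)) = contradiction (m%n%d≡0⇒d∣m (Q u v) 24 3 (divides 8 refl) ≡0) 3∤Q
    classify (inj₂ (inj₂ (inj₁ (≡5 , u%2≡1)))) =
      inj₁ (≡5 , λ 2∣u → 0≢1+n (trans (sym (n∣m⇒m%n≡0 u 2 2∣u)) u%2≡1))
    classify (inj₂ (inj₂ (inj₂ (≡11 , u%2≡0)))) = inj₂ (≡11 , m%n≡0⇒n∣m u 2 u%2≡0)

  X²+216Y²≡8m⇒m%24 : ∀ X Y m → X * X + 216 * (Y * Y) ≡ 8 * m → ¬ 2 ∣ m → ¬ 3 ∣ m →
                     (m % 24 ≡ 5 × 4 ∣ X × ¬ 8 ∣ X) ⊎ (m % 24 ≡ 11 × 8 ∣ X)
  X²+216Y²≡8m⇒m%24 X Y m eq = conclude (X²+216Y²≡8m⇒X≡4U X Y m eq)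
    where
    conclude : ∃ (λ U → X ≡ U * 4 × Q U Y ≡ m) → ¬ 2 ∣ m → ¬ 3 ∣ m →
               (m % 24 ≡ 5 × 4 ∣ X × ¬ 8 ∣ X) ⊎ (m % 24 ≡ 11 × 8 ∣ X)
    conclude (U , refl , refl) 2∤m 3∤m =
      Sum.map (Product.map₂ 4∣4U∧8∤4U) (Product.map₂ (*-monoˡ-∣ 4)) (Q-%-24 U Y 2∤m 3∤m)
      where
      4∣4U∧8∤4U : ¬ 2 ∣ U → 4 ∣ U * 4 × ¬ 8 ∣ U * 4
      4∣4U∧8∤4U 2∤U = divides U refl , λ 8∣4U → 2∤U (*-cancelʳ-∣ 4 8∣4U)

open import Defs
open import Data.Nat using (ℕ; _>_; _%_) renaming (_*_ to _*ℕ_)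
open import Data.Nat.GCD using (gcd)
open import Data.Integer using (ℤ; +_; _+_; _*_)
open import Data.Integer.GCD using () renaming (gcd to gcdℤ)
open import Data.Product using (_×_)
open import Data.Sum using (_⊎_)
open import Relation.Binary.PropositionalEquality using (_≡_)

open import Data.Nat using () renaming (_+_ to _+ℕ_)
open import Data.Nat.Coprimality using (gcd≡1⇒coprime)
open import Data.Nat.Divisibility using (divides) renaming (_∣_ to _∣ℕ_)
open import Data.Integer using (∣_∣; -[1+_])
open import Data.Integer.Properties using (pos-*; pos-+; +-injective)
open import Data.Product using (_,_)
open import Data.Sum using (inj₁; inj₂)
open import Relation.Nullary using (¬_; contradiction)
open import Relation.Binary.PropositionalEquality using (refl; sym; trans; cong; cong₂; module ≡-Reasoning)
open OverNaturals using (X²+216Y²≡8m⇒m%24)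

i*i≡+∣i∣*∣i∣ : ∀ i → i * i ≡ + (∣ i ∣ *ℕ ∣ i ∣)
i*i≡+∣i∣*∣i∣ (+ n)    = sym (pos-* n n)
i*i≡+∣i∣*∣i∣ -[1+ n ] = refl

∣x∣²+216∣y∣²≡8m : ∀ x y m → x * x + + 216 * (y * y) ≡ + (8 *ℕ m) →
                  ∣ x ∣ *ℕ ∣ x ∣ +ℕ 216 *ℕ (∣ y ∣ *ℕ ∣ y ∣) ≡ 8 *ℕ m
∣x∣²+216∣y∣²≡8m x y m eq = +-injective (begin
  + (∣x∣² +ℕ 216 *ℕ ∣y∣²)      ≡⟨ pos-+ ∣x∣² (216 *ℕ ∣y∣²) ⟩
  + ∣x∣² + + (216 *ℕ ∣y∣²)     ≡⟨ cong (λ t → + ∣x∣² + t) (pos-* 216 ∣y∣²) ⟩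
  + ∣x∣² + + 216 * + ∣y∣²      ≡⟨ cong₂ (λ s t → s + + 216 * t) (i*i≡+∣i∣*∣i∣ x) (i*i≡+∣i∣*∣i∣ y) ⟨
  x * x + + 216 * (y * y)      ≡⟨ eq ⟩
  + (8 *ℕ m)                   ∎)
  where
  open ≡-Reasoning
  ∣x∣² = ∣ x ∣ *ℕ ∣ x ∣
  ∣y∣² = ∣ y ∣ *ℕ ∣ y ∣

lemma2p6 : (m : ℕ) → m > 0 → gcd m 6 ≡ 1 →
    (x y : ℤ) → gcdℤ x y ≡ + 1 → x * x + + 216 * (y * y) ≡ + (8 *ℕ m) →
    ((m % 24 ≡ 5) ⊎ (m % 24 ≡ 11))
    × (m % 24 ≡ 5 → Val₂≡ x 2)
    × (m % 24 ≡ 11 → Val₂≥ x 3)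
lemma2p6 m _ gcd[m,6]≡1 x y _ eq =
  conclude (X²+216Y²≡8m⇒m%24 ∣ x ∣ ∣ y ∣ m (∣x∣²+216∣y∣²≡8m x y m eq) 2∤m 3∤m)
  where
  2∤m : ¬ 2 ∣ℕ m
  2∤m 2∣m = contradiction (gcd≡1⇒coprime gcd[m,6]≡1 (2∣m , divides 3 refl)) λ ()
  3∤m : ¬ 3 ∣ℕ m
  3∤m 3∣m = contradiction (gcd≡1⇒coprime gcd[m,6]≡1 (3∣m , divides 2 refl)) λ ()
  -- Divisibility on ℤ is divisibility of absolute values, so Val₂ needs nothing beyond ∣ x ∣.
  conclude : (m % 24 ≡ 5 × 4 ∣ℕ ∣ x ∣ × ¬ 8 ∣ℕ ∣ x ∣) ⊎ (m % 24 ≡ 11 × 8 ∣ℕ ∣ x ∣) →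
             ((m % 24 ≡ 5) ⊎ (m % 24 ≡ 11)) × (m % 24 ≡ 5 → Val₂≡ x 2) × (m % 24 ≡ 11 → Val₂≥ x 3)
  conclude (inj₁ (≡5 , 4∣x , 8∤x)) = inj₁ ≡5 , (λ _ → 4∣x , 8∤x) , λ ≡11 → contradiction (trans (sym ≡5) ≡11) λ ()
  conclude (inj₂ (≡11 , 8∣x))      = inj₂ ≡11 , (λ ≡5 → contradiction (trans (sym ≡5) ≡11) λ ()) , λ _ → 8∣x
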